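{- Let $p$ be a prime with $p\equiv1\pmod4$, let $u_p=(t+b\sqrt p)/2>1$ ($t,b$ positive integers) be the fundamental unit of $\mathbb Q(\sqrt p)$, let $A,B$ be integers with $p=A^2+B^2$, $A\equiv-1\pmod4$, $p\mid At+2B$, and let $x_0,y_0$ and $\{\mathcal F_n\},\{\mathcal L_n\}$ be as in the context. Then for every integer $n$ and each choice of sign, $$bp\,\mathcal F_{4n\pm1}\mp\mathcal L_{4n\pm1}A-2B=2p\,(x_0\mathcal F_{2n}\pm y_0\mathcal F_{2n\pm1})^2.$$
   Context: $x_0:=\sqrt{\frac{bp+(At+2B)}{2p}}$ and $y_0:=\kappa\sqrt{\frac{bp-(At+2B)}{2p}}$, where $\kappa\in\{1,-1\}$ is chosen so that $x_0y_0=\frac{Bt-2A}{2p}$ (these are real since $bp\ge|At+2B|$). Sequences indexed by $n\in\mathbb Z$: $\mathcal F_0=0,\ \mathcal F_1=1,\ \mathcal F_{n+2}=t\mathcal F_{n+1}+\mathcal F_n$ and $\mathcal L_0=2,\ \mathcal L_1=t,\ \mathcal L_{n+2}=t\mathcal L_{n+1}+\mathcal L_n$. -}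

module Defs where

open import Level using (Level)
open import Data.Nat as ℕ using (ℕ; zero; suc)
open import Data.Nat.Primality using (Prime)
open import Data.Integer as ℤ using (ℤ; +_; -[1+_]; _+_; _*_; _-_; -_; _≤_; _<_)
open import Data.Integer.Divisibility using (_∣_)
open import Data.Product using (_×_; _,_; proj₁; proj₂)
open import Data.Sum using (_⊎_)
open import Relation.Binary.PropositionalEquality using (_≡_)
open import Algebra.Bundles using (CommutativeRing)

-- Lucas-type sequence W with W₀ = a, W₁ = c and W_{n+2} = t W_{n+1} + W_n,
-- extended to all of ℤ by running the same recurrence backwards
-- (W_n = W_{n+2} - t W_{n+1}).
fwd : ℤ → ℤ → ℤ → ℕ → ℤ × ℤ
fwd t a c zero    = a , c
fwd t a c (suc k) = let (x , y) = fwd t a c k in y , (t * y + x)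

bwd : ℤ → ℤ → ℤ → ℕ → ℤ × ℤ          -- bwd t a c k = (W_{-(k+1)} , W_{-k})
bwd t a c zero    = (c - t * a) , a
bwd t a c (suc k) = let (x , y) = bwd t a c k in (y - t * x) , x

seqW : ℤ → ℤ → ℤ → ℤ → ℤ
seqW t a c (+ k)      = proj₁ (fwd t a c k)
seqW t a c -[1+ k ]   = proj₁ (bwd t a c k)

𝓕 : ℤ → ℤ → ℤ
𝓕 t = seqW t (+ 0) (+ 1)

𝓛 : ℤ → ℤ → ℤ
𝓛 t = seqW t (+ 2) t

-- (t + b√p)/2 with t, b > 0 is a unit of the ring of integers of ℚ(√p)
-- (p ≡ 1 mod 4) iff t² - p b² = ±4.
IsUnitPair : ℕ → ℤ → ℤ → Set
IsUnitPair p t b = (+ 0 < t) × (+ 0 < b) ×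
  ((t * t - (+ p) * (b * b) ≡ + 4) ⊎ (t * t - (+ p) * (b * b) ≡ - (+ 4)))

-- u_p = (t + b√p)/2 > 1 is the fundamental unit: it is a unit > 1 (i.e. t, b > 0)
-- and every unit (t' + b'√p)/2 > 1 satisfies u_p ≤ (t' + b'√p)/2
-- (stated coordinatewise, since there are no reals available).
IsFundamentalUnit : ℕ → ℤ → ℤ → Set
IsFundamentalUnit p t b = IsUnitPair p t b ×
  (∀ t' b' → IsUnitPair p t' b' → (t ≤ t') × (b ≤ b'))

module _ {c ℓ : Level} (R : CommutativeRing c ℓ) where
  open CommutativeRing R renaming (_+_ to _+ᴿ_; _*_ to _*ᴿ_; -_ to -ᴿ_)

  natR : ℕ → Carrier
  natR zero    = 0#
  natR (suc n) = 1# +ᴿ natR n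

  intR : ℤ → Carrier
  intR (+ n)    = natR n
  intR -[1+ n ] = -ᴿ natR (suc n)

-- With f = 𝓕 m and g = 𝓕 (m + 1), the addition formula gives 𝓕 (2m+1) = f² + g² and
-- 𝓛 (2m+1) = 4fg + t(g² − f²), and Cassini's identity g² − tgf − f² = (−1)^m replaces the
-- constant 2B. For m = 2n this turns bp𝓕 (4n+1) − 𝓛 (4n+1) A − 2B into the binary quadratic
-- form f²(bp + (At+2B)) + 2fg(Bt−2A) + g²(bp − (At+2B)); for m = 2n − 1 the same happens for
-- bp𝓕 (4n−1) + 𝓛 (4n−1) A − 2B with the pair (g, −f). The three coefficients are 2p x₀²,
-- 2p x₀y₀ and 2p y₀², so the form is 2p (x₀ a + y₀ c)².
module Submission where

open import Defs
open import Level using (Level)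
open import Data.Nat as ℕ using (ℕ; zero; suc)
import Data.Nat.Properties as ℕP
open import Data.Nat.DivMod using (_%_)
open import Data.Nat.Primality using (Prime)
open import Data.Integer as ℤ
  using (ℤ; +_; -[1+_]; _+_; _*_; _-_; -_; _⊖_; _◃_; 0ℤ; 1ℤ; -1ℤ) renaming (suc to sucℤ)
import Data.Integer.Properties as ℤP
open import Data.Integer.Divisibility using (_∣_)
open import Data.Integer.Tactic.RingSolver using (solve-∀)
import Data.Sign.Base as Sign
open import Data.Maybe using (map)
open import Relation.Nullary.Decidable using (dec⇒maybe)
open import Data.Product using (_×_; _,_; proj₁)
open import Function using (_∘_)
open import Relation.Binary.PropositionalEquality as ≡ using (_≡_)
open import Algebra.Bundles using (CommutativeRing)
open import Algebra.Properties.AbelianGroup ℤP.+-0-abelianGroup using () renaming (∙-cancelˡ to +-cancelˡ)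
import Algebra.Solver.Ring.AlmostCommutativeRing as ACR

module LucasSequences where

  open ≡ using (refl; sym; trans; cong; cong₂; module ≡-Reasoning)

  ℤ-induction : (P : ℤ → Set) → P 0ℤ → (∀ n → P n → P (sucℤ n)) → (∀ n → P (sucℤ n) → P n) →
                ∀ n → P n
  ℤ-induction P P₀ up down (+ zero)     = P₀
  ℤ-induction P P₀ up down (+ suc k)    = up (+ k) (ℤ-induction P P₀ up down (+ k))
  ℤ-induction P P₀ up down -[1+ zero ]  = down -[1+ 0 ] P₀
  ℤ-induction P P₀ up down -[1+ suc k ] = down -[1+ suc k ] (ℤ-induction P P₀ up down -[1+ k ])

  sucℤ-+ : ∀ m n → sucℤ m + n ≡ sucℤ (m + n)
  sucℤ-+ = ℤP.+-assoc 1ℤ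

  -- solve-∀ treats defined functions (sucℤ, cassiniForm, binaryForm) as atoms, so identities
  -- involving them are proved in unfolded form.
  sucℤ[2n-1]≡2n : ∀ n → sucℤ (+ 2 * n - + 1) ≡ + 2 * n
  sucℤ[2n-1]≡2n = expanded
    where
    expanded : ∀ n → + 1 + (+ 2 * n - + 1) ≡ + 2 * n
    expanded = solve-∀

  -- A record rather than a Π-type, so that U can be inferred from a proof of Recurrent t U.
  record Recurrent (t : ℤ) (U : ℤ → ℤ) : Set where
    constructor recurrent
    field step : ∀ n → U (sucℤ (sucℤ n)) ≡ t * U (sucℤ n) + U n
  open Recurrent

  x≡y+[x-y] : ∀ x y → x ≡ y + (x - y)
  x≡y+[x-y] = solve-∀

  seqW-recurrent : ∀ t a c → Recurrent t (seqW t a c)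
  seqW-recurrent t a c = recurrent λ where
    (+ k)              → refl
    -[1+ 0 ]           → x≡y+[x-y] c (t * a)
    -[1+ 1 ]           → x≡y+[x-y] a (t * (c - t * a))
    -[1+ suc (suc k) ] → let (x , y) = bwd t a c k in x≡y+[x-y] x (t * (y - t * x))

  module _ {t : ℤ} where

    recurrent-unique : ∀ {U V} → Recurrent t U → Recurrent t V → U 0ℤ ≡ V 0ℤ → U 1ℤ ≡ V 1ℤ →
                       ∀ n → U n ≡ V n
    recurrent-unique {U} {V} recU recV e₀ e₁ n = proj₁ (ℤ-induction Agree (e₀ , e₁) up down n)
      where
      Agree : ℤ → Set
      Agree n = U n ≡ V n × U (sucℤ n) ≡ V (sucℤ n)
      up : ∀ n → Agree n → Agree (sucℤ n)
      up n (eₙ , eₙ₊₁) =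
        eₙ₊₁ , trans (step recU n) (trans (cong₂ (λ u v → t * u + v) eₙ₊₁ eₙ) (sym (step recV n)))
      down : ∀ n → Agree (sucℤ n) → Agree n
      down n (eₙ₊₁ , eₙ₊₂) =
        +-cancelˡ (t * U (sucℤ n)) (U n) (V n)
          (trans (sym (step recU n)) (trans eₙ₊₂ (trans (step recV n) (cong (λ v → t * v + V n) (sym eₙ₊₁)))))
        , eₙ₊₁

    recurrent-∘suc : ∀ {U} → Recurrent t U → Recurrent t (U ∘ sucℤ)
    recurrent-∘suc rec = recurrent (step rec ∘ sucℤ)

    recurrent-shift : ∀ {U} j → Recurrent t U → Recurrent t (λ n → U (n + j))
    recurrent-shift {U} j rec = recurrent λ n → begin
      U (sucℤ (sucℤ n) + j)            ≡⟨ cong U (sucℤ-+ (sucℤ n) j) ⟩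
      U (sucℤ (sucℤ n + j))            ≡⟨ cong (U ∘ sucℤ) (sucℤ-+ n j) ⟩
      U (sucℤ (sucℤ (n + j)))          ≡⟨ step rec (n + j) ⟩
      t * U (sucℤ (n + j)) + U (n + j) ≡⟨ cong (λ i → t * U i + U (n + j)) (sucℤ-+ n j) ⟨
      t * U (sucℤ n + j) + U (n + j)   ∎
      where open ≡-Reasoning

    recurrent-linear : ∀ {U V} α β → Recurrent t U → Recurrent t V →
                       Recurrent t (λ n → α * U n + β * V n)
    recurrent-linear {U} {V} α β recU recV = recurrent λ n → begin
      α * U (sucℤ (sucℤ n)) + β * V (sucℤ (sucℤ n))
        ≡⟨ cong₂ (λ u v → α * u + β * v) (step recU n) (step recV n) ⟩
      α * (t * U (sucℤ n) + U n) + β * (t * V (sucℤ n) + V n)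
        ≡⟨ regroup α β t (U (sucℤ n)) (U n) (V (sucℤ n)) (V n) ⟩
      t * (α * U (sucℤ n) + β * V (sucℤ n)) + (α * U n + β * V n) ∎
      where
      open ≡-Reasoning
      regroup : ∀ α β t u₁ u₀ v₁ v₀ →
                α * (t * u₁ + u₀) + β * (t * v₁ + v₀) ≡ t * (α * u₁ + β * v₁) + (α * u₀ + β * v₀)
      regroup = solve-∀

  cassiniForm : ℤ → ℤ → ℤ → ℤ
  cassiniForm t a c = c * c - t * c * a - a * a

  cassiniForm-step : ∀ t a c → cassiniForm t c (t * c + a) ≡ - cassiniForm t a c
  cassiniForm-step = expanded
    where
    expanded : ∀ t a c → (t * c + a) * (t * c + a) - t * (t * c + a) * c - c * c ≡ - (c * c - t * c * a - a * a)
    expanded = solve-∀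

  binaryForm : ℤ → ℤ → ℤ → ℤ → ℤ → ℤ
  binaryForm P S Q a c = a * a * P + (a * c + a * c) * S + c * c * Q

  module _ (t : ℤ) where

    private
      F L : ℤ → ℤ
      F = 𝓕 t
      L = 𝓛 t

    𝓕-recurrent : Recurrent t F
    𝓕-recurrent = seqW-recurrent t (+ 0) (+ 1)

    𝓛-recurrent : Recurrent t L
    𝓛-recurrent = seqW-recurrent t (+ 2) t

    𝓕-+ : ∀ m k → F (k + sucℤ m) ≡ F m * F k + F (sucℤ m) * F (sucℤ k)
    𝓕-+ m = recurrent-unique
      (recurrent-shift (sucℤ m) 𝓕-recurrent)
      (recurrent-linear (F m) (F (sucℤ m)) 𝓕-recurrent (recurrent-∘suc 𝓕-recurrent))
      (trans (cong F (ℤP.+-identityˡ (sucℤ m))) (at₀ (F m) (F (sucℤ m))))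
      (trans (step 𝓕-recurrent m) (at₁ t (F m) (F (sucℤ m))))
      where
      at₀ : ∀ u v → v ≡ u * + 0 + v * + 1
      at₀ = solve-∀
      at₁ : ∀ t u v → t * v + u ≡ u * + 1 + v * (t * + 1 + + 0)
      at₁ = solve-∀

    𝓛≡𝓕 : ∀ n → L n ≡ + 2 * F (sucℤ n) - t * F n
    𝓛≡𝓕 n = trans
      (recurrent-unique 𝓛-recurrent
        (recurrent-linear (+ 2) (- t) (recurrent-∘suc 𝓕-recurrent) 𝓕-recurrent)
        (at₀ t) (at₁ t) n)
      (cong (λ x → + 2 * F (sucℤ n) + x) (sym (ℤP.neg-distribˡ-* t (F n))))
      where
      at₀ : ∀ t → + 2 ≡ + 2 * + 1 + - t * + 0
      at₀ = solve-∀
      at₁ : ∀ t → t ≡ + 2 * (t * + 1 + + 0) + - t * + 1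
      at₁ = solve-∀

    𝓛-odd : ∀ m → L (m + sucℤ m) ≡ + 4 * F m * F (sucℤ m) + t * (F (sucℤ m) * F (sucℤ m) - F m * F m)
    𝓛-odd m = begin
      L (m + sucℤ m)                                          ≡⟨ 𝓛≡𝓕 (m + sucℤ m) ⟩
      + 2 * F (sucℤ (m + sucℤ m)) - t * F (m + sucℤ m)        ≡⟨ cong (λ i → + 2 * F i - t * F (m + sucℤ m)) (sucℤ-+ m (sucℤ m)) ⟨
      + 2 * F (sucℤ m + sucℤ m) - t * F (m + sucℤ m)          ≡⟨ cong₂ (λ u v → + 2 * u - t * v) (𝓕-+ m (sucℤ m)) (𝓕-+ m m) ⟩
      + 2 * (f * g + g * F (sucℤ (sucℤ m))) - t * (f * f + g * g)
        ≡⟨ cong (λ h → + 2 * (f * g + g * h) - t * (f * f + g * g)) (step 𝓕-recurrent m) ⟩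
      + 2 * (f * g + g * (t * g + f)) - t * (f * f + g * g)   ≡⟨ simplify t f g ⟩
      + 4 * f * g + t * (g * g - f * f)                       ∎
      where
      open ≡-Reasoning
      f = F m
      g = F (sucℤ m)
      simplify : ∀ t f g → + 2 * (f * g + g * (t * g + f)) - t * (f * f + g * g) ≡ + 4 * f * g + t * (g * g - f * f)
      simplify = solve-∀

    cassini : ℤ → ℤ
    cassini m = cassiniForm t (F m) (F (sucℤ m))

    cassini-suc : ∀ m → cassini (sucℤ m) ≡ - cassini m
    cassini-suc m = trans (cong (cassiniForm t (F (sucℤ m))) (step 𝓕-recurrent m)) (cassiniForm-step t (F m) (F (sucℤ m)))

    cassini-even : ∀ n → cassini (+ 2 * n) ≡ 1ℤ
    cassini-even = ℤ-induction (λ n → cassini (+ 2 * n) ≡ 1ℤ) (at₀ t)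
      (λ n e → trans (cong cassini (double-suc n)) (trans (cassini-suc-suc (+ 2 * n)) e))
      (λ n e → trans (sym (cassini-suc-suc (+ 2 * n))) (trans (cong cassini (sym (double-suc n))) e))
      where
      at₀ : ∀ t → + 1 * + 1 - t * + 1 * + 0 - + 0 * + 0 ≡ + 1
      at₀ = solve-∀
      double-suc : ∀ n → + 2 * sucℤ n ≡ sucℤ (sucℤ (+ 2 * n))
      double-suc = expanded
        where
        expanded : ∀ n → + 2 * (+ 1 + n) ≡ + 1 + (+ 1 + + 2 * n)
        expanded = solve-∀
      cassini-suc-suc : ∀ m → cassini (sucℤ (sucℤ m)) ≡ cassini m
      cassini-suc-suc m = trans (cassini-suc (sucℤ m)) (trans (cong -_ (cassini-suc m)) (ℤP.neg-involutive (cassini m)))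

    cassini-odd : ∀ n → cassini (+ 2 * n - + 1) ≡ -1ℤ
    cassini-odd n = begin
      cassini m                ≡⟨ ℤP.neg-involutive (cassini m) ⟨
      - - cassini m            ≡⟨ cong -_ (cassini-suc m) ⟨
      - cassini (sucℤ m)       ≡⟨ cong (λ i → - cassini i) (sucℤ[2n-1]≡2n n) ⟩
      - cassini (+ 2 * n)      ≡⟨ cong -_ (cassini-even n) ⟩
      -1ℤ                      ∎
      where
      open ≡-Reasoning
      m = + 2 * n - + 1

    module _ (b P A B : ℤ) where

      private
        form : ℤ → ℤ → ℤ
        form = binaryForm (b * P + (A * t + + 2 * B)) (B * t - + 2 * A) (b * P - (A * t + + 2 * B))

      odd-index-identity⁺ : ∀ m → cassini m ≡ 1ℤ →
        b * P * F (m + sucℤ m) - L (m + sucℤ m) * A - + 2 * B ≡ form (F m) (F (sucℤ m))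
      odd-index-identity⁺ m cas = begin
        b * P * F (m + sucℤ m) - L (m + sucℤ m) * A - + 2 * B
          ≡⟨ cong₂ (λ u v → b * P * u - v * A - + 2 * B) (𝓕-+ m m) (𝓛-odd m) ⟩
        X - + 2 * B                    ≡⟨ cong (λ e → X - e) (ℤP.*-identityʳ (+ 2 * B)) ⟨
        X - + 2 * B * 1ℤ               ≡⟨ cong (λ e → X - + 2 * B * e) cas ⟨
        X - + 2 * B * cassiniForm t f g ≡⟨ expanded t b P A B f g ⟩
        form f g                       ∎
        where
        open ≡-Reasoning
        f = F m
        g = F (sucℤ m)
        X = b * P * (f * f + g * g) - (+ 4 * f * g + t * (g * g - f * f)) * A
        expanded : ∀ t b P A B f g →
          b * P * (f * f + g * g) - (+ 4 * f * g + t * (g * g - f * f)) * A - + 2 * B * (g * g - t * g * f - f * f) ≡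
          f * f * (b * P + (A * t + + 2 * B)) + (f * g + f * g) * (B * t - + 2 * A) + g * g * (b * P - (A * t + + 2 * B))
        expanded = solve-∀

      odd-index-identity⁻ : ∀ m → cassini m ≡ -1ℤ →
        b * P * F (m + sucℤ m) + L (m + sucℤ m) * A - + 2 * B ≡ form (F (sucℤ m)) (- F m)
      odd-index-identity⁻ m cas = begin
        b * P * F (m + sucℤ m) + L (m + sucℤ m) * A - + 2 * B
          ≡⟨ cong₂ (λ u v → b * P * u + v * A - + 2 * B) (𝓕-+ m m) (𝓛-odd m) ⟩
        X - + 2 * B                     ≡⟨ cong (λ e → X + e) (trans (ℤP.*-comm (+ 2 * B) -1ℤ) (ℤP.-1*i≡-i (+ 2 * B))) ⟨
        X + + 2 * B * -1ℤ               ≡⟨ cong (λ e → X + + 2 * B * e) cas ⟨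
        X + + 2 * B * cassiniForm t f g ≡⟨ expanded t b P A B f g ⟩
        form g (- f)                    ∎
        where
        open ≡-Reasoning
        f = F m
        g = F (sucℤ m)
        X = b * P * (f * f + g * g) + (+ 4 * f * g + t * (g * g - f * f)) * A
        expanded : ∀ t b P A B f g →
          b * P * (f * f + g * g) + (+ 4 * f * g + t * (g * g - f * f)) * A + + 2 * B * (g * g - t * g * f - f * f) ≡
          g * g * (b * P + (A * t + + 2 * B)) + (g * - f + g * - f) * (B * t - + 2 * A) + - f * - f * (b * P - (A * t + + 2 * B))
        expanded = solve-∀

      identity-4n+1 : ∀ n →
        b * P * F (+ 4 * n + + 1) - L (+ 4 * n + + 1) * A - + 2 * B ≡ form (F (+ 2 * n)) (F (+ 2 * n + + 1))
      identity-4n+1 n = begin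
        b * P * F (+ 4 * n + + 1) - L (+ 4 * n + + 1) * A - + 2 * B
          ≡⟨ cong (λ k → b * P * F k - L k * A - + 2 * B) (index n) ⟩
        b * P * F (m + sucℤ m) - L (m + sucℤ m) * A - + 2 * B
          ≡⟨ odd-index-identity⁺ m (cassini-even n) ⟩
        form (F m) (F (sucℤ m))
          ≡⟨ cong (form (F m) ∘ F) (ℤP.+-comm 1ℤ m) ⟩
        form (F m) (F (m + + 1)) ∎
        where
        open ≡-Reasoning
        m = + 2 * n
        index : ∀ n → + 4 * n + + 1 ≡ + 2 * n + (+ 1 + + 2 * n)
        index = solve-∀

      identity-4n-1 : ∀ n →
        b * P * F (+ 4 * n - + 1) + L (+ 4 * n - + 1) * A - + 2 * B ≡ form (F (+ 2 * n)) (- F (+ 2 * n - + 1))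
      identity-4n-1 n = begin
        b * P * F (+ 4 * n - + 1) + L (+ 4 * n - + 1) * A - + 2 * B
          ≡⟨ cong (λ k → b * P * F k + L k * A - + 2 * B) (index n) ⟩
        b * P * F (m + sucℤ m) + L (m + sucℤ m) * A - + 2 * B
          ≡⟨ odd-index-identity⁻ m (cassini-odd n) ⟩
        form (F (sucℤ m)) (- F m)
          ≡⟨ cong (λ k → form (F k) (- F m)) (sucℤ[2n-1]≡2n n) ⟩
        form (F (+ 2 * n)) (- F m) ∎
        where
        open ≡-Reasoning
        m = + 2 * n - + 1
        index : ∀ n → + 4 * n - + 1 ≡ (+ 2 * n - + 1) + (+ 1 + (+ 2 * n - + 1))
        index = solve-∀

open LucasSequences

module IntegerImage {c ℓ : Level} (R : CommutativeRing c ℓ) where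
  open CommutativeRing R
    renaming (_+_ to _+ᴿ_; _*_ to _*ᴿ_; -_ to -ᴿ_; _-_ to _-ᴿ_)
  open import Algebra.Properties.Ring ring using (-0#≈0#; -‿involutive; -‿+-comm; -‿distribˡ-*; -‿distribʳ-*)
  open import Algebra.Properties.CommutativeSemigroup +-commutativeSemigroup using (interchange)
  open import Algebra.Properties.Semiring.Mult semiring using (×-homo-+; ×1-homo-*) renaming (_×_ to _×ᴿ_)
  open import Relation.Binary.Reasoning.Setoid setoid

  private
    ι : ℤ → Carrier
    ι = intR R

  natR≈×1# : ∀ n → natR R n ≈ n ×ᴿ 1#
  natR≈×1# zero    = refl
  natR≈×1# (suc n) = +-congˡ (natR≈×1# n)

  natR-+ : ∀ m n → natR R (m ℕ.+ n) ≈ natR R m +ᴿ natR R n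
  natR-+ m n = begin
    natR R (m ℕ.+ n)      ≈⟨ natR≈×1# (m ℕ.+ n) ⟩
    (m ℕ.+ n) ×ᴿ 1#        ≈⟨ ×-homo-+ 1# m n ⟩
    m ×ᴿ 1# +ᴿ n ×ᴿ 1#     ≈⟨ +-cong (natR≈×1# m) (natR≈×1# n) ⟨
    natR R m +ᴿ natR R n  ∎

  natR-* : ∀ m n → natR R (m ℕ.* n) ≈ natR R m *ᴿ natR R n
  natR-* m n = begin
    natR R (m ℕ.* n)      ≈⟨ natR≈×1# (m ℕ.* n) ⟩
    (m ℕ.* n) ×ᴿ 1#        ≈⟨ ×1-homo-* m n ⟩
    m ×ᴿ 1# *ᴿ n ×ᴿ 1#     ≈⟨ *-cong (natR≈×1# m) (natR≈×1# n) ⟨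
    natR R m *ᴿ natR R n  ∎

  intR-⊖ : ∀ m n → ι (m ⊖ n) ≈ natR R m -ᴿ natR R n
  intR-⊖ zero    zero    = sym (-‿inverseʳ 0#)
  intR-⊖ zero    (suc n) = sym (+-identityˡ _)
  intR-⊖ (suc m) zero    = trans (sym (+-identityʳ _)) (+-congˡ (sym -0#≈0#))
  intR-⊖ (suc m) (suc n) = begin
    ι (suc m ⊖ suc n)              ≡⟨ ≡.cong ι (ℤP.[1+m]⊖[1+n]≡m⊖n m n) ⟩
    ι (m ⊖ n)                      ≈⟨ intR-⊖ m n ⟩
    x -ᴿ y                         ≈⟨ +-identityˡ _ ⟨
    0# +ᴿ (x -ᴿ y)                 ≈⟨ +-congʳ (-‿inverseʳ 1#) ⟨
    (1# -ᴿ 1#) +ᴿ (x -ᴿ y)         ≈⟨ interchange 1# (-ᴿ 1#) x (-ᴿ y) ⟩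
    (1# +ᴿ x) +ᴿ (-ᴿ 1# +ᴿ -ᴿ y)   ≈⟨ +-congˡ (-‿+-comm 1# y) ⟩
    (1# +ᴿ x) -ᴿ (1# +ᴿ y)         ∎
    where
    x = natR R m
    y = natR R n

  intR-neg : ∀ i → ι (- i) ≈ -ᴿ ι i
  intR-neg (+ zero)  = sym -0#≈0#
  intR-neg (+ suc n) = refl
  intR-neg -[1+ n ]  = sym (-‿involutive _)

  intR-+ : ∀ i j → ι (i + j) ≈ ι i +ᴿ ι j
  intR-+ (+ m)    (+ n)    = natR-+ m n
  intR-+ (+ m)    -[1+ n ] = intR-⊖ m (suc n)
  intR-+ -[1+ m ] (+ n)    = trans (intR-⊖ n (suc m)) (+-comm _ _)
  intR-+ -[1+ m ] -[1+ n ] = begin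
    -ᴿ natR R (suc (suc (m ℕ.+ n)))         ≡⟨ ≡.cong (λ k → -ᴿ natR R (suc k)) (ℕP.+-suc m n) ⟨
    -ᴿ natR R (suc m ℕ.+ suc n)             ≈⟨ -‿cong (natR-+ (suc m) (suc n)) ⟩
    -ᴿ (natR R (suc m) +ᴿ natR R (suc n))   ≈⟨ -‿+-comm _ _ ⟨
    -ᴿ natR R (suc m) +ᴿ -ᴿ natR R (suc n)  ∎

  intR-+◃ : ∀ n → ι (Sign.+ ◃ n) ≈ natR R n
  intR-+◃ n = reflexive (≡.cong ι (ℤP.+◃n≡+n n))

  intR--◃ : ∀ n → ι (Sign.- ◃ n) ≈ -ᴿ natR R n
  intR--◃ n = trans (reflexive (≡.cong ι (ℤP.-◃n≡-n n))) (intR-neg (+ n))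

  intR-* : ∀ i j → ι (i * j) ≈ ι i *ᴿ ι j
  intR-* (+ m)    (+ n)    = trans (intR-+◃ (m ℕ.* n)) (natR-* m n)
  intR-* (+ m)    -[1+ n ] =
    trans (intR--◃ (m ℕ.* suc n)) (trans (-‿cong (natR-* m (suc n))) (-‿distribʳ-* _ _))
  intR-* -[1+ m ] (+ n)    =
    trans (intR--◃ (suc m ℕ.* n)) (trans (-‿cong (natR-* (suc m) n)) (-‿distribˡ-* _ _))
  intR-* -[1+ m ] -[1+ n ] = begin
    ι (+ (suc m ℕ.* suc n))                    ≈⟨ intR-+◃ (suc m ℕ.* suc n) ⟩
    natR R (suc m ℕ.* suc n)                   ≈⟨ natR-* (suc m) (suc n) ⟩
    x *ᴿ y                                     ≈⟨ -‿involutive _ ⟨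
    -ᴿ -ᴿ (x *ᴿ y)                             ≈⟨ -‿cong (-‿distribˡ-* x y) ⟩
    -ᴿ (-ᴿ x *ᴿ y)                             ≈⟨ -‿distribʳ-* (-ᴿ x) y ⟩
    -ᴿ x *ᴿ -ᴿ y                               ∎
    where
    x = natR R (suc m)
    y = natR R (suc n)

  intR-homomorphism : ℤ.+-*-rawRing ACR.-Raw-AlmostCommutative⟶ ACR.fromCommutativeRing R
  intR-homomorphism = record
    { ⟦_⟧ = ι ; +-homo = intR-+ ; *-homo = intR-* ; -‿homo = intR-neg
    ; 0-homo = refl ; 1-homo = +-identityʳ 1# }

  open import Algebra.Solver.Ring ℤ.+-*-rawRing (ACR.fromCommutativeRing R) intR-homomorphism
    (λ i j → map (reflexive ∘ ≡.cong ι) (dec⇒maybe (i ℤP.≟ j)))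

  intR-binaryForm : ∀ P S Q a c →
    ι (binaryForm P S Q a c) ≈ ι a *ᴿ ι a *ᴿ ι P +ᴿ (ι a *ᴿ ι c +ᴿ ι a *ᴿ ι c) *ᴿ ι S +ᴿ ι c *ᴿ ι c *ᴿ ι Q
  intR-binaryForm P S Q a c = begin
    ι (a * a * P + (a * c + a * c) * S + c * c * Q)
      ≈⟨ intR-+ (a * a * P + (a * c + a * c) * S) (c * c * Q) ⟩
    ι (a * a * P + (a * c + a * c) * S) +ᴿ ι (c * c * Q)
      ≈⟨ +-congʳ (intR-+ (a * a * P) ((a * c + a * c) * S)) ⟩
    ι (a * a * P) +ᴿ ι ((a * c + a * c) * S) +ᴿ ι (c * c * Q)
      ≈⟨ +-cong (+-cong (intR-** a a P) (intR-* (a * c + a * c) S)) (intR-** c c Q) ⟩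
    ι a *ᴿ ι a *ᴿ ι P +ᴿ ι (a * c + a * c) *ᴿ ι S +ᴿ ι c *ᴿ ι c *ᴿ ι Q
      ≈⟨ +-congʳ (+-congˡ (*-congʳ (trans (intR-+ (a * c) (a * c)) (+-cong (intR-* a c) (intR-* a c))))) ⟩
    ι a *ᴿ ι a *ᴿ ι P +ᴿ (ι a *ᴿ ι c +ᴿ ι a *ᴿ ι c) *ᴿ ι S +ᴿ ι c *ᴿ ι c *ᴿ ι Q ∎
    where
    intR-** : ∀ u v w → ι (u * v * w) ≈ ι u *ᴿ ι v *ᴿ ι w
    intR-** u v w = trans (intR-* (u * v) w) (*-congʳ (intR-* u v))

  binaryForm-square : ∀ {X x y P S Q} → X *ᴿ (x *ᴿ x) ≈ ι P → X *ᴿ (y *ᴿ y) ≈ ι Q → X *ᴿ (x *ᴿ y) ≈ ι S →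
    ∀ a c → ι (binaryForm P S Q a c) ≈ X *ᴿ ((x *ᴿ ι a +ᴿ y *ᴿ ι c) *ᴿ (x *ᴿ ι a +ᴿ y *ᴿ ι c))
  binaryForm-square {X} {x} {y} {P} {S} {Q} hx hy hxy a c = begin
    ι (binaryForm P S Q a c)
      ≈⟨ intR-binaryForm P S Q a c ⟩
    α *ᴿ α *ᴿ ι P +ᴿ (α *ᴿ γ +ᴿ α *ᴿ γ) *ᴿ ι S +ᴿ γ *ᴿ γ *ᴿ ι Q
      ≈⟨ +-cong (+-cong (*-congˡ hx) (*-congˡ hxy)) (*-congˡ hy) ⟨
    α *ᴿ α *ᴿ (X *ᴿ (x *ᴿ x)) +ᴿ (α *ᴿ γ +ᴿ α *ᴿ γ) *ᴿ (X *ᴿ (x *ᴿ y)) +ᴿ γ *ᴿ γ *ᴿ (X *ᴿ (y *ᴿ y))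
      ≈⟨ solve 5 (λ X x y α γ → α :* α :* (X :* (x :* x)) :+ (α :* γ :+ α :* γ) :* (X :* (x :* y)) :+ γ :* γ :* (X :* (y :* y))
                               := X :* ((x :* α :+ y :* γ) :* (x :* α :+ y :* γ))) refl X x y α γ ⟩
    X *ᴿ ((x *ᴿ α +ᴿ y *ᴿ γ) *ᴿ (x *ᴿ α +ᴿ y *ᴿ γ)) ∎
    where
    α = ι a
    γ = ι c

  binaryForm-square⁻ : ∀ {X x y P S Q} → X *ᴿ (x *ᴿ x) ≈ ι P → X *ᴿ (y *ᴿ y) ≈ ι Q → X *ᴿ (x *ᴿ y) ≈ ι S →
    ∀ a c → ι (binaryForm P S Q a (- c)) ≈ X *ᴿ ((x *ᴿ ι a -ᴿ y *ᴿ ι c) *ᴿ (x *ᴿ ι a -ᴿ y *ᴿ ι c))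
  binaryForm-square⁻ {X} {x} {y} hx hy hxy a c =
    trans (binaryForm-square hx hy hxy a (- c)) (*-congˡ (*-cong y·ι[-c] y·ι[-c]))
    where
    y·ι[-c] : x *ᴿ ι a +ᴿ y *ᴿ ι (- c) ≈ x *ᴿ ι a -ᴿ y *ᴿ ι c
    y·ι[-c] = +-congˡ (trans (*-congˡ (intR-neg c)) (sym (-‿distribʳ-* y (ι c))))

open IntegerImage

lemma8 : {c ℓ : Level} (R : CommutativeRing c ℓ) →
  (p : ℕ) (t b A B : ℤ) →
  Prime p → p % 4 ≡ 1 →
  IsFundamentalUnit p t b →
  + p ≡ A * A + B * B → (+ 4) ∣ (A + + 1) → (+ p) ∣ (A * t + (+ 2) * B) →
  (x₀ y₀ : CommutativeRing.Carrier R) →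
  CommutativeRing._≈_ R (CommutativeRing._*_ R (intR R (+ 2 * + p)) (CommutativeRing._*_ R x₀ x₀))
    (intR R (b * + p + (A * t + + 2 * B))) →
  CommutativeRing._≈_ R (CommutativeRing._*_ R (intR R (+ 2 * + p)) (CommutativeRing._*_ R y₀ y₀))
    (intR R (b * + p - (A * t + + 2 * B))) →
  CommutativeRing._≈_ R (CommutativeRing._*_ R (intR R (+ 2 * + p)) (CommutativeRing._*_ R x₀ y₀))
    (intR R (B * t - + 2 * A)) →
  (n : ℤ) →
  CommutativeRing._≈_ R
    (intR R (b * + p * 𝓕 t (+ 4 * n + + 1) - 𝓛 t (+ 4 * n + + 1) * A - + 2 * B))
    (CommutativeRing._*_ R (intR R (+ 2 * + p))
      (CommutativeRing._*_ R
        (CommutativeRing._+_ R (CommutativeRing._*_ R x₀ (intR R (𝓕 t (+ 2 * n))))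
                               (CommutativeRing._*_ R y₀ (intR R (𝓕 t (+ 2 * n + + 1)))))
        (CommutativeRing._+_ R (CommutativeRing._*_ R x₀ (intR R (𝓕 t (+ 2 * n))))
                               (CommutativeRing._*_ R y₀ (intR R (𝓕 t (+ 2 * n + + 1)))))))
  ×
  CommutativeRing._≈_ R
    (intR R (b * + p * 𝓕 t (+ 4 * n - + 1) + 𝓛 t (+ 4 * n - + 1) * A - + 2 * B))
    (CommutativeRing._*_ R (intR R (+ 2 * + p))
      (CommutativeRing._*_ R
        (CommutativeRing._-_ R (CommutativeRing._*_ R x₀ (intR R (𝓕 t (+ 2 * n))))
                               (CommutativeRing._*_ R y₀ (intR R (𝓕 t (+ 2 * n - + 1)))))
        (CommutativeRing._-_ R (CommutativeRing._*_ R x₀ (intR R (𝓕 t (+ 2 * n))))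
                               (CommutativeRing._*_ R y₀ (intR R (𝓕 t (+ 2 * n - + 1)))))))
lemma8 R p t b A B _ _ _ _ _ _ x₀ y₀ hx hy hxy n =
  trans (reflexive (≡.cong (intR R) (identity-4n+1 t b (+ p) A B n)))
        (binaryForm-square R hx hy hxy (𝓕 t (+ 2 * n)) (𝓕 t (+ 2 * n + + 1))) ,
  trans (reflexive (≡.cong (intR R) (identity-4n-1 t b (+ p) A B n)))
        (binaryForm-square⁻ R hx hy hxy (𝓕 t (+ 2 * n)) (𝓕 t (+ 2 * n - + 1)))
  where open CommutativeRing R using (trans; reflexive)
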